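{- For every integer $n \ge 0$ and every integer $k \ge 1$, the number of cliques of size $k$ in the $123$-core $U_n$ is $\binom{n+1}{2k}$.
   Context: For $n \ge 0$, the $123$-core $U_n$ is the simple graph with vertex set $\{(i,j) : 1 \le i \le j \le n\}$, where $(i,j)$ and $(k,\ell)$ are adjacent if and only if either ($k < i$ and $j < \ell$) or ($i < k$ and $\ell < j$). ($U_0$ is the empty graph.) A clique of size $k$ is a set of $k$ pairwise adjacent vertices. -}

module Defs where

open import Data.Nat using (ℕ; zero; suc; _<_; _≤_; _≤?_; _<?_)
open import Data.Product using (_×_; _,_)
open import Data.Sum using (_⊎_)
open import Data.List using (List; []; _∷_; _++_; map; concatMap; length; filter; upTo)
open import Data.List.Relation.Unary.AllPairs using (AllPairs; allPairs?)
open import Relation.Nullary using (Dec; yes; no)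
open import Relation.Nullary.Decidable using (_×-dec_; _⊎-dec_)

-- A vertex of U_n is a pair (i , j) with 1 ≤ i ≤ j ≤ n.
Vertex : Set
Vertex = ℕ × ℕ

vertices : ℕ → List Vertex
vertices n = concatMap (λ j → map (λ i → (suc i , j)) (upTo j)) (map suc (upTo n))

Adj : Vertex → Vertex → Set
Adj (i , j) (k , l) = (k < i × j < l) ⊎ (i < k × l < j)

Adj? : (u v : Vertex) → Dec (Adj u v)
Adj? (i , j) (k , l) = ((k <? i) ×-dec (j <? l)) ⊎-dec ((i <? k) ×-dec (l <? j))

-- All sub-sequences of a list (the subsets of its set of entries,
-- when the list has no duplicates).
sublists : {A : Set} → List A → List (List A)
sublists []       = [] ∷ []
sublists (x ∷ xs) = sublists xs ++ map (x ∷_) (sublists xs)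

ksubsets : ℕ → ℕ → List (List Vertex)
ksubsets n k = filter (λ s → length s Data.Nat.≟ k) (sublists (vertices n))
  where import Data.Nat

-- A set of vertices is a clique iff its elements are pairwise adjacent
-- (Adj is symmetric, so AllPairs along the list is pairwise adjacency).
IsClique : List Vertex → Set
IsClique = AllPairs Adj

numCliques : ℕ → ℕ → ℕ
numCliques n k = length (filter (allPairs? Adj?) (ksubsets n k))

-- A clique of U_n is a chain of vertices whose rows strictly increase while
-- their columns strictly decrease.  Classify the k-cliques by their lowest
-- vertex (i, j): the other k - 1 vertices form a clique of the rectangle with
-- columns < i and rows > j, in which the constraint column ≤ row is void, so
-- there are C(i-1, k-1) * C(n-j, k-1) of them.  Summing over i by the hockey
-- stick identity gives C(j, k) * C(n-j, k-1), and summing over j by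
-- Chu–Vandermonde gives C(n+1, 2k).
module Submission where

open import Defs
open import Data.Nat using (ℕ; zero; suc; _+_; _*_; _≥_; _≟_; _≤_; _<_; z≤n; s≤s; z<s; s<s)
open import Data.Nat.Combinatorics using (_C_; nCk+nC[k+1]≡[n+1]C[k+1])
open import Algebra.Properties.CommutativeSemigroup using (interchange)
open import Data.Bool using (true; false)
open import Data.List using (List; []; _∷_; _++_; _∷ʳ_; map; filter; length; applyUpTo; concat; concatMap; upTo)
open import Data.List.Properties
  using (filter-++; filter-≐; filter-none; filter-accept; length-++; length-map; ++-identityʳ;
         map-applyUpTo; map-upTo; applyUpTo-∷ʳ; map-cong)
open import Data.List.Relation.Unary.All as All using (All; []; _∷_; all?)
open import Data.List.Relation.Unary.All.Properties as All using ()
open import Data.List.Relation.Unary.AllPairs using (AllPairs; []; _∷_; allPairs?)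
open import Data.List.Relation.Unary.AllPairs.Properties as AllPairs using ()
open import Data.Nat.ListAction using (sum)
open import Data.Nat.ListAction.Properties using (sum-++)
open import Data.Nat.Properties
  using (suc-injective; +-identityʳ; +-comm; +-assoc; +-suc; *-identityʳ; *-zeroʳ; *-distribˡ-+;
         *-distribʳ-+; <-irrefl; <-asym; <-trans; <⇒≤; <⇒≱; n<1+n; ≤-refl; m≤n⇒m≤1+n;
         +-commutativeSemigroup)
open import Data.Nat.Tactic.RingSolver using (solve-∀)
open import Data.Product using (_×_; _,_)
open import Data.Sum using (inj₁; inj₂)
open import Function using (id; _∘_)
open import Level using (0ℓ)
open import Relation.Binary.PropositionalEquality using (_≡_; refl; sym; trans; cong; cong₂; module ≡-Reasoning)
open import Relation.Nullary using (Dec; yes; no; ¬_; does)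
open import Relation.Unary using (Pred; Decidable; _∩_)
open import Relation.Unary.Properties using (_∩?_)

module _ {A : Set} {P Q : Pred A 0ℓ} (P? : Decidable P) (Q? : Decidable Q) where

  filter-filter : ∀ xs → filter P? (filter Q? xs) ≡ filter (Q? ∩? P?) xs
  filter-filter []       = refl
  filter-filter (x ∷ xs) with does (Q? x)
  ... | false = filter-filter xs
  ... | true with does (P? x)
  ...   | true  = cong (x ∷_) (filter-filter xs)
  ...   | false = filter-filter xs

module _ {A B : Set} {P : Pred A 0ℓ} (P? : Decidable P) (f : B → A) where

  filter-map : ∀ xs → filter P? (map f xs) ≡ map f (filter (P? ∘ f) xs)
  filter-map []       = refl
  filter-map (x ∷ xs) with does (P? (f x))
  ... | true  = cong (f x ∷_) (filter-map xs)
  ... | false = filter-map xs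

module _ {A : Set} {P : Pred (List A) 0ℓ} (P? : Decidable P) where

  length-filter-sublists-∷ : ∀ x xs → length (filter P? (sublists (x ∷ xs))) ≡
    length (filter P? (sublists xs)) + length (filter (λ s → P? (x ∷ s)) (sublists xs))
  length-filter-sublists-∷ x xs = begin
    length (filter P? (sublists xs ++ map (x ∷_) (sublists xs)))
      ≡⟨ cong length (filter-++ P? (sublists xs) _) ⟩
    length (filter P? (sublists xs) ++ filter P? (map (x ∷_) (sublists xs)))
      ≡⟨ length-++ (filter P? (sublists xs)) ⟩
    length (filter P? (sublists xs)) + length (filter P? (map (x ∷_) (sublists xs)))
      ≡⟨ cong (length (filter P? (sublists xs)) +_)
              (trans (cong length (filter-map P? (x ∷_) (sublists xs)))
                     (length-map (x ∷_) (filter (λ s → P? (x ∷ s)) (sublists xs)))) ⟩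
    length (filter P? (sublists xs)) + length (filter (λ s → P? (x ∷ s)) (sublists xs)) ∎
    where open ≡-Reasoning

module _ {A : Set} {Q : Pred A 0ℓ} (Q? : Decidable Q) where

  filter-All-sublists : ∀ xs → filter (all? Q?) (sublists xs) ≡ sublists (filter Q? xs)
  filter-All-sublists []       = refl
  filter-All-sublists (x ∷ xs) with Q? x
  ... | yes qx = begin
    filter (all? Q?) (sublists xs ++ map (x ∷_) (sublists xs))
      ≡⟨ filter-++ (all? Q?) (sublists xs) _ ⟩
    filter (all? Q?) (sublists xs) ++ filter (all? Q?) (map (x ∷_) (sublists xs))
      ≡⟨ cong (filter (all? Q?) (sublists xs) ++_) (filter-map (all? Q?) (x ∷_) (sublists xs)) ⟩
    filter (all? Q?) (sublists xs) ++ map (x ∷_) (filter (λ s → all? Q? (x ∷ s)) (sublists xs))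
      ≡⟨ cong (λ ss → filter (all? Q?) (sublists xs) ++ map (x ∷_) ss)
              (filter-≐ (λ s → all? Q? (x ∷ s)) (all? Q?) ((λ where (_ ∷ qs) → qs) , (qx ∷_))
                        (sublists xs)) ⟩
    filter (all? Q?) (sublists xs) ++ map (x ∷_) (filter (all? Q?) (sublists xs))
      ≡⟨ cong (λ ss → ss ++ map (x ∷_) ss) (filter-All-sublists xs) ⟩
    sublists (filter Q? xs) ++ map (x ∷_) (sublists (filter Q? xs)) ∎
    where open ≡-Reasoning
  ... | no ¬qx = begin
    filter (all? Q?) (sublists xs ++ map (x ∷_) (sublists xs))
      ≡⟨ filter-++ (all? Q?) (sublists xs) _ ⟩
    filter (all? Q?) (sublists xs) ++ filter (all? Q?) (map (x ∷_) (sublists xs))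
      ≡⟨ cong (filter (all? Q?) (sublists xs) ++_)
              (filter-none (all? Q?) (All.map⁺ (All.universal (λ where _ (qx ∷ _) → ¬qx qx) (sublists xs)))) ⟩
    filter (all? Q?) (sublists xs) ++ []
      ≡⟨ ++-identityʳ _ ⟩
    filter (all? Q?) (sublists xs)
      ≡⟨ filter-All-sublists xs ⟩
    sublists (filter Q? xs) ∎
    where open ≡-Reasoning

applyUpTo-cong : {A : Set} (f g : ℕ → A) (n : ℕ) → (∀ {i} → i < n → f i ≡ g i) →
                 applyUpTo f n ≡ applyUpTo g n
applyUpTo-cong f g zero    _   = refl
applyUpTo-cong f g (suc n) f≡g = cong₂ _∷_ (f≡g z<s) (applyUpTo-cong (f ∘ suc) (g ∘ suc) n (f≡g ∘ s<s))

filter-applyUpTo : {A : Set} {P : Pred A 0ℓ} (P? : Decidable P) (f : ℕ → A) {a L : ℕ} → a ≤ L →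
  (∀ {c} → c < a → P (f c)) → (∀ {c} → a ≤ c → ¬ P (f c)) → filter P? (applyUpTo f L) ≡ applyUpTo f a
filter-applyUpTo P? f {zero}  {L}     _         _      reject =
  filter-none P? (All.applyUpTo⁺₂ f L (λ _ → reject z≤n))
filter-applyUpTo P? f {suc a} {suc L} (s≤s a≤L) accept reject =
  trans (filter-accept P? (accept z<s))
        (cong (f 0 ∷_) (filter-applyUpTo P? (f ∘ suc) a≤L (accept ∘ s<s) (reject ∘ s≤s)))

-- Binomial sums

sum-applyUpTo-*ʳ : ∀ f x n → sum (applyUpTo (λ i → f i * x) n) ≡ sum (applyUpTo f n) * x
sum-applyUpTo-*ʳ f x zero    = refl
sum-applyUpTo-*ʳ f x (suc n) =
  trans (cong (f 0 * x +_) (sum-applyUpTo-*ʳ (f ∘ suc) x n)) (sym (*-distribʳ-+ x (f 0) _))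

hockey-stick : ∀ k n → sum (applyUpTo (_C k) n) ≡ n C suc k
hockey-stick k zero    = refl
hockey-stick k (suc n) = begin
  sum (applyUpTo (_C k) (suc n))          ≡⟨ cong sum (applyUpTo-∷ʳ (_C k) n) ⟨
  sum (applyUpTo (_C k) n ∷ʳ n C k)       ≡⟨ sum-++ (applyUpTo (_C k) n) (n C k ∷ []) ⟩
  sum (applyUpTo (_C k) n) + (n C k + 0)  ≡⟨ cong₂ _+_ (hockey-stick k n) (+-identityʳ (n C k)) ⟩
  n C suc k + n C k                       ≡⟨ +-comm (n C suc k) (n C k) ⟩
  n C k + n C suc k                       ≡⟨ nCk+nC[k+1]≡[n+1]C[k+1] n k ⟩
  suc n C suc k                           ∎
  where open ≡-Reasoning

-- conv g h m n = ∑_{j < n} g (m + j) * h (n ∸ suc j)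
conv : (ℕ → ℕ) → (ℕ → ℕ) → ℕ → ℕ → ℕ
conv g h m zero    = 0
conv g h m (suc n) = g m * h n + conv g h (suc m) n

conv-suc : ∀ g h m n → conv g h (suc m) n ≡ conv (g ∘ suc) h m n
conv-suc g h m zero    = refl
conv-suc g h m (suc n) = cong (g (suc m) * h n +_) (conv-suc g h (suc m) n)

conv-1 : ∀ g n → conv g (λ _ → 1) 0 n ≡ sum (applyUpTo g n)
conv-1 g zero    = refl
conv-1 g (suc n) = cong₂ _+_ (*-identityʳ (g 0)) (trans (conv-suc g (λ _ → 1) 0 n) (conv-1 (g ∘ suc) n))

conv-pascal : ∀ g b m n → conv g (_C suc b) m (suc n) ≡ conv g (_C b) m n + conv g (_C suc b) m n
conv-pascal g b m zero    = trans (+-identityʳ (g m * 0)) (*-zeroʳ (g m))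
conv-pascal g b m (suc n) = begin
  g m * (suc n C suc b) + conv g (_C suc b) (suc m) (suc n)
    ≡⟨ cong₂ _+_ (cong (g m *_) (sym (nCk+nC[k+1]≡[n+1]C[k+1] n b))) (conv-pascal g b (suc m) n) ⟩
  g m * (n C b + n C suc b) + (conv₁ + conv₂)
    ≡⟨ cong (_+ (conv₁ + conv₂)) (*-distribˡ-+ (g m) (n C b) (n C suc b)) ⟩
  (g m * (n C b) + g m * (n C suc b)) + (conv₁ + conv₂)
    ≡⟨ interchange +-commutativeSemigroup (g m * (n C b)) (g m * (n C suc b)) conv₁ conv₂ ⟩
  (g m * (n C b) + conv₁) + (g m * (n C suc b) + conv₂) ∎
  where
  open ≡-Reasoning
  conv₁ conv₂ : ℕ
  conv₁ = conv g (_C b) (suc m) n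
  conv₂ = conv g (_C suc b) (suc m) n

chu-vandermonde : ∀ a b n → conv (_C a) (_C b) 0 n ≡ n C suc (a + b)
chu-vandermonde a b       zero    = refl
chu-vandermonde a zero    (suc n) = begin
  conv (_C a) (λ _ → 1) 0 (suc n)  ≡⟨ conv-1 (_C a) (suc n) ⟩
  sum (applyUpTo (_C a) (suc n))   ≡⟨ hockey-stick a (suc n) ⟩
  suc n C suc a                    ≡⟨ cong (λ c → suc n C suc c) (+-identityʳ a) ⟨
  suc n C suc (a + 0)              ∎
  where open ≡-Reasoning
chu-vandermonde a (suc b) (suc n) = begin
  conv (_C a) (_C suc b) 0 (suc n)
    ≡⟨ conv-pascal (_C a) b 0 n ⟩
  conv (_C a) (_C b) 0 n + conv (_C a) (_C suc b) 0 n
    ≡⟨ cong₂ _+_ (chu-vandermonde a b n) (chu-vandermonde a (suc b) n) ⟩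
  n C suc (a + b) + n C suc (a + suc b)
    ≡⟨ cong (λ c → n C suc (a + b) + n C suc c) (+-suc a b) ⟩
  n C suc (a + b) + n C suc (suc (a + b))
    ≡⟨ nCk+nC[k+1]≡[n+1]C[k+1] n (suc (a + b)) ⟩
  suc n C suc (suc (a + b))
    ≡⟨ cong (λ c → suc n C suc c) (+-suc a b) ⟨
  suc n C suc (a + suc b) ∎
  where open ≡-Reasoning

-- Counting cliques of a decidable relation

module _ {A : Set} {R : A → A → Set} (R? : ∀ x y → Dec (R x y)) where

  cliqueCount : List A → ℕ → ℕ
  cliqueCount xs       zero    = 1
  cliqueCount []       (suc k) = 0
  cliqueCount (x ∷ xs) (suc k) = cliqueCount xs (suc k) + cliqueCount (filter (R? x) xs) k

  sizedClique? : ∀ k → Decidable ((λ s → length s ≡ k) ∩ AllPairs R)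
  sizedClique? k = (λ s → length s ≟ k) ∩? allPairs? R?

  cliqueCount-sublists : ∀ xs k → length (filter (sizedClique? k) (sublists xs)) ≡ cliqueCount xs k
  cliqueCount-sublists []       zero    = refl
  cliqueCount-sublists []       (suc k) = refl
  cliqueCount-sublists (x ∷ xs) zero    = begin
    length (filter (sizedClique? 0) (sublists (x ∷ xs)))
      ≡⟨ length-filter-sublists-∷ (sizedClique? 0) x xs ⟩
    length (filter (sizedClique? 0) (sublists xs)) +
    length (filter (λ s → sizedClique? 0 (x ∷ s)) (sublists xs))
      ≡⟨ cong₂ _+_ (cliqueCount-sublists xs 0)
                   (cong length (filter-none (λ s → sizedClique? 0 (x ∷ s))
                                             (All.universal (λ where _ (() , _)) (sublists xs)))) ⟩
    1 + 0 ∎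
    where open ≡-Reasoning
  cliqueCount-sublists (x ∷ xs) (suc k) = begin
    length (filter (sizedClique? (suc k)) (sublists (x ∷ xs)))
      ≡⟨ length-filter-sublists-∷ (sizedClique? (suc k)) x xs ⟩
    length (filter (sizedClique? (suc k)) (sublists xs)) +
    length (filter (λ s → sizedClique? (suc k) (x ∷ s)) (sublists xs))
      ≡⟨ cong (length (filter (sizedClique? (suc k)) (sublists xs)) +_) (cong length cliquesThrough-x) ⟩
    length (filter (sizedClique? (suc k)) (sublists xs)) +
    length (filter (sizedClique? k) (sublists (filter (R? x) xs)))
      ≡⟨ cong₂ _+_ (cliqueCount-sublists xs (suc k)) (cliqueCount-sublists (filter (R? x) xs) k) ⟩
    cliqueCount (x ∷ xs) (suc k) ∎
    where
    open ≡-Reasoning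
    extend : ∀ {s} → length (x ∷ s) ≡ suc k × AllPairs R (x ∷ s) → All (R x) s × length s ≡ k × AllPairs R s
    extend (eq , rx ∷ ps) = rx , suc-injective eq , ps
    restrict : ∀ {s} → All (R x) s × length s ≡ k × AllPairs R s → length (x ∷ s) ≡ suc k × AllPairs R (x ∷ s)
    restrict (rx , eq , ps) = cong suc eq , rx ∷ ps
    cliquesThrough-x : filter (λ s → sizedClique? (suc k) (x ∷ s)) (sublists xs) ≡
                       filter (sizedClique? k) (sublists (filter (R? x) xs))
    cliquesThrough-x = begin
      filter (λ s → sizedClique? (suc k) (x ∷ s)) (sublists xs)
        ≡⟨ filter-≐ _ (all? (R? x) ∩? sizedClique? k) (extend , restrict) (sublists xs) ⟩
      filter (all? (R? x) ∩? sizedClique? k) (sublists xs)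
        ≡⟨ filter-filter (sizedClique? k) (all? (R? x)) (sublists xs) ⟨
      filter (sizedClique? k) (filter (all? (R? x)) (sublists xs))
        ≡⟨ cong (filter (sizedClique? k)) (filter-All-sublists (R? x) xs) ⟩
      filter (sizedClique? k) (sublists (filter (R? x) xs)) ∎

  cliqueCount-independent-++ : ∀ {ys} zs k → AllPairs (λ x y → ¬ R x y) ys →
    cliqueCount (ys ++ zs) (suc k) ≡
    cliqueCount zs (suc k) + sum (map (λ y → cliqueCount (filter (R? y) zs) k) ys)
  cliqueCount-independent-++ zs k [] = sym (+-identityʳ _)
  cliqueCount-independent-++ {y ∷ ys} zs k (y≁ys ∷ ys-independent) = begin
    cliqueCount (ys ++ zs) (suc k) + cliqueCount (filter (R? y) (ys ++ zs)) k
      ≡⟨ cong₂ _+_ (cliqueCount-independent-++ zs k ys-independent)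
                   (cong (λ ws → cliqueCount ws k) filter-y) ⟩
    (cliqueCount zs (suc k) + branches) + branch y
      ≡⟨ +-assoc (cliqueCount zs (suc k)) branches (branch y) ⟩
    cliqueCount zs (suc k) + (branches + branch y)
      ≡⟨ cong (cliqueCount zs (suc k) +_) (+-comm branches (branch y)) ⟩
    cliqueCount zs (suc k) + (branch y + branches) ∎
    where
    open ≡-Reasoning
    branch : A → ℕ
    branch y = cliqueCount (filter (R? y) zs) k
    branches : ℕ
    branches = sum (map branch ys)
    filter-y : filter (R? y) (ys ++ zs) ≡ filter (R? y) zs
    filter-y = trans (filter-++ (R? y) ys zs) (cong (_++ filter (R? y) zs) (filter-none (R? y) y≁ys))

-- Rows, rectangles and staircases in the grid

row : ℕ → ℕ → List Vertex
row w d = applyUpTo (λ c → (suc c , d)) w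

-- Rows m + 1, …, m + n, where row d consists of the columns 1, …, w d.
block : (ℕ → ℕ) → ℕ → ℕ → List Vertex
block w m zero    = []
block w m (suc n) = row (w (suc m)) (suc m) ++ block w (suc m) n

rectangle : ℕ → ℕ → ℕ → List Vertex
rectangle L = block (λ _ → L)

staircase : ℕ → ℕ → List Vertex
staircase = block id

¬Adj-sameRow : ∀ {a c d} → ¬ Adj (a , d) (c , d)
¬Adj-sameRow (inj₁ (_ , d<d)) = <-irrefl refl d<d
¬Adj-sameRow (inj₂ (_ , d<d)) = <-irrefl refl d<d

row-independent : ∀ w d → AllPairs (λ u v → ¬ Adj u v) (row w d)
row-independent w d = AllPairs.applyUpTo⁺₂ _ w (λ _ _ → ¬Adj-sameRow)

filter-Adj-row : ∀ {a b w d} → b < d → a ≤ w → filter (Adj? (suc a , b)) (row w d) ≡ row a d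
filter-Adj-row b<d a≤w = filter-applyUpTo (Adj? _) _ a≤w
  (λ c<a → inj₁ (s≤s c<a , b<d))
  (λ where a≤c (inj₁ (s≤s c<a , _)) → <⇒≱ c<a a≤c
           _   (inj₂ (_ , d<b))     → <-asym b<d d<b)

filter-Adj-block : ∀ {a b} w m n → b ≤ m → (∀ {e} → m < e → a ≤ w e) →
  filter (Adj? (suc a , b)) (block w m n) ≡ rectangle a m n
filter-Adj-block w m zero    _   _   = refl
filter-Adj-block {a} {b} w m (suc n) b≤m a≤w = begin
  filter (Adj? (suc a , b)) (row (w (suc m)) (suc m) ++ block w (suc m) n)
    ≡⟨ filter-++ (Adj? (suc a , b)) (row (w (suc m)) (suc m)) (block w (suc m) n) ⟩
  filter (Adj? (suc a , b)) (row (w (suc m)) (suc m)) ++ filter (Adj? (suc a , b)) (block w (suc m) n)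
    ≡⟨ cong₂ _++_ (filter-Adj-row (s≤s b≤m) (a≤w ≤-refl))
                  (filter-Adj-block w (suc m) n (m≤n⇒m≤1+n b≤m) (a≤w ∘ <-trans (n<1+n m))) ⟩
  row a (suc m) ++ rectangle a (suc m) n ∎
  where open ≡-Reasoning

cliqueCount-block-suc : ∀ w m n k → (∀ {c e} → c < w (suc m) → suc m < e → c ≤ w e) →
  cliqueCount Adj? (block w m (suc n)) (suc k) ≡
  cliqueCount Adj? (block w (suc m) n) (suc k) +
  sum (applyUpTo (λ c → cliqueCount Adj? (rectangle c (suc m) n) k) (w (suc m)))
cliqueCount-block-suc w m n k narrow = begin
  cliqueCount Adj? (row (w (suc m)) (suc m) ++ rest) (suc k)
    ≡⟨ cliqueCount-independent-++ Adj? rest k (row-independent (w (suc m)) (suc m)) ⟩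
  cliqueCount Adj? rest (suc k) + sum (map branch (row (w (suc m)) (suc m)))
    ≡⟨ cong (λ bs → cliqueCount Adj? rest (suc k) + sum bs) (begin
      map branch (row (w (suc m)) (suc m))
        ≡⟨ map-applyUpTo _ branch (w (suc m)) ⟩
      applyUpTo (λ c → branch (suc c , suc m)) (w (suc m))
        ≡⟨ applyUpTo-cong _ _ (w (suc m)) (λ c<w →
             cong (λ zs → cliqueCount Adj? zs k) (filter-Adj-block w (suc m) n ≤-refl (narrow c<w))) ⟩
      applyUpTo (λ c → cliqueCount Adj? (rectangle c (suc m) n) k) (w (suc m)) ∎) ⟩
  cliqueCount Adj? rest (suc k) + sum (applyUpTo (λ c → cliqueCount Adj? (rectangle c (suc m) n) k) (w (suc m))) ∎
  where
  open ≡-Reasoning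
  rest : List Vertex
  rest = block w (suc m) n
  branch : Vertex → ℕ
  branch y = cliqueCount Adj? (filter (Adj? y) rest) k

cliqueCount-rectangle : ∀ L m n k → cliqueCount Adj? (rectangle L m n) k ≡ (L C k) * (n C k)
sum-cliqueCount-rectangle : ∀ L m n k →
  sum (applyUpTo (λ c → cliqueCount Adj? (rectangle c m n) k) L) ≡ (L C suc k) * (n C k)

cliqueCount-rectangle L m n       zero    = refl
cliqueCount-rectangle L m zero    (suc k) = sym (*-zeroʳ (L C suc k))
cliqueCount-rectangle L m (suc n) (suc k) = begin
  cliqueCount Adj? (rectangle L m (suc n)) (suc k)
    ≡⟨ cliqueCount-block-suc (λ _ → L) m n k (λ c<L _ → <⇒≤ c<L) ⟩
  cliqueCount Adj? (rectangle L (suc m) n) (suc k) +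
  sum (applyUpTo (λ c → cliqueCount Adj? (rectangle c (suc m) n) k) L)
    ≡⟨ cong₂ _+_ (cliqueCount-rectangle L (suc m) n (suc k)) (sum-cliqueCount-rectangle L (suc m) n k) ⟩
  (L C suc k) * (n C suc k) + (L C suc k) * (n C k)
    ≡⟨ *-distribˡ-+ (L C suc k) (n C suc k) (n C k) ⟨
  (L C suc k) * (n C suc k + n C k)
    ≡⟨ cong ((L C suc k) *_) (trans (+-comm (n C suc k) (n C k)) (nCk+nC[k+1]≡[n+1]C[k+1] n k)) ⟩
  (L C suc k) * (suc n C suc k) ∎
  where open ≡-Reasoning

sum-cliqueCount-rectangle L m n k = begin
  sum (applyUpTo (λ c → cliqueCount Adj? (rectangle c m n) k) L)
    ≡⟨ cong sum (applyUpTo-cong _ _ L (λ {c} _ → cliqueCount-rectangle c m n k)) ⟩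
  sum (applyUpTo (λ c → (c C k) * (n C k)) L)
    ≡⟨ sum-applyUpTo-*ʳ (_C k) (n C k) L ⟩
  sum (applyUpTo (_C k) L) * (n C k)
    ≡⟨ cong (_* (n C k)) (hockey-stick k L) ⟩
  (L C suc k) * (n C k) ∎
  where open ≡-Reasoning

cliqueCount-staircase : ∀ m n k → cliqueCount Adj? (staircase m n) (suc k) ≡ conv (_C suc k) (_C k) (suc m) n
cliqueCount-staircase m zero    k = refl
cliqueCount-staircase m (suc n) k = begin
  cliqueCount Adj? (staircase m (suc n)) (suc k)
    ≡⟨ cliqueCount-block-suc id m n k (λ c<m m<e → <⇒≤ (<-trans c<m m<e)) ⟩
  cliqueCount Adj? (staircase (suc m) n) (suc k) +
  sum (applyUpTo (λ c → cliqueCount Adj? (rectangle c (suc m) n) k) (suc m))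
    ≡⟨ cong₂ _+_ (cliqueCount-staircase (suc m) n k) (sum-cliqueCount-rectangle (suc m) (suc m) n k) ⟩
  conv (_C suc k) (_C k) (suc (suc m)) n + (suc m C suc k) * (n C k)
    ≡⟨ +-comm (conv (_C suc k) (_C k) (suc (suc m)) n) _ ⟩
  conv (_C suc k) (_C k) (suc m) (suc n) ∎
  where open ≡-Reasoning

concatMap-diagonal-rows : ∀ m n →
  concatMap (λ j → row j j) (applyUpTo (λ i → suc (m + i)) n) ≡ staircase m n
concatMap-diagonal-rows m zero    = refl
concatMap-diagonal-rows m (suc n) =
  cong₂ _++_ (cong (λ j → row (suc j) (suc j)) (+-identityʳ m))
             (trans (cong (concatMap (λ j → row j j))
                          (applyUpTo-cong _ _ n (λ {i} _ → cong suc (+-suc m i))))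
                    (concatMap-diagonal-rows (suc m) n))

vertices≡staircase : ∀ n → vertices n ≡ staircase 0 n
vertices≡staircase n = begin
  concatMap (λ j → map (λ i → (suc i , j)) (upTo j)) (map suc (upTo n))
    ≡⟨ cong concat (map-cong (λ j → map-upTo (λ i → (suc i , j)) j) (map suc (upTo n))) ⟩
  concatMap (λ j → row j j) (map suc (upTo n))
    ≡⟨ cong (concatMap (λ j → row j j)) (map-upTo suc n) ⟩
  concatMap (λ j → row j j) (applyUpTo suc n)
    ≡⟨ concatMap-diagonal-rows 0 n ⟩
  staircase 0 n ∎
  where open ≡-Reasoning

mainTheorem5 : (n k : ℕ) → k ≥ 1 → numCliques n k ≡ (n + 1) C (2 * k)
mainTheorem5 n zero    ()
mainTheorem5 n (suc k) _ = begin
  length (filter (allPairs? Adj?) (filter (λ s → length s ≟ suc k) (sublists (vertices n))))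
    ≡⟨ cong length (filter-filter (allPairs? Adj?) (λ s → length s ≟ suc k) (sublists (vertices n))) ⟩
  length (filter (sizedClique? Adj? (suc k)) (sublists (vertices n)))
    ≡⟨ cliqueCount-sublists Adj? (vertices n) (suc k) ⟩
  cliqueCount Adj? (vertices n) (suc k)
    ≡⟨ cong (λ vs → cliqueCount Adj? vs (suc k)) (vertices≡staircase n) ⟩
  cliqueCount Adj? (staircase 0 n) (suc k)
    ≡⟨ cliqueCount-staircase 0 n k ⟩
  conv (_C suc k) (_C k) 0 (suc n)
    ≡⟨ chu-vandermonde (suc k) k (suc n) ⟩
  suc n C suc (suc k + k)
    ≡⟨ cong₂ _C_ (+-comm 1 n) (2+k+k≡2*[1+k] k) ⟩
  (n + 1) C (2 * suc k) ∎
  where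
  open ≡-Reasoning
  2+k+k≡2*[1+k] : ∀ k → suc (suc k + k) ≡ 2 * suc k
  2+k+k≡2*[1+k] = solve-∀
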